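{- Let $\mathcal{C}$ be an $\mathbb{F}_{q^n}$-subspace of $V$. Suppose $g(x)=\sum_{m=0}^{n-1}g_mx^{q^m}$ is an invertible linearised polynomial such that $g\circ\mathcal{C}=\{g\circ f: f\in\mathcal{C}\}$ is also an $\mathbb{F}_{q^n}$-subspace of $V$. Then for every $m$ with $g_m\neq 0$ it holds that $g\circ\mathcal{C}=x^{q^m}\circ\mathcal{C}$.
   Context: $V=\mathrm{End}_{\mathbb{F}_q}(\mathbb{F}_{q^n})$, viewed as the $n$-dimensional $\mathbb{F}_{q^n}$-vector space of linearised polynomials $f(x)=\sum_{i=0}^{n-1}f_ix^{q^i}$ with $f_i\in\mathbb{F}_{q^n}$ (scalar multiplication $(\alpha f)(x)=\alpha f(x)$). Composition $f\circ g$ is $f(g(x))\bmod (x^{q^n}-x)$. A linearised polynomial is invertible if it has no nonzero root in $\mathbb{F}_{q^n}$. -}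

module Defs where

open import Level using (0ℓ)
open import Data.Nat as ℕ using (ℕ; zero; suc; NonZero)
open import Data.Nat.DivMod using (_%_; m%n<n)
open import Data.Fin as Fin using (Fin; toℕ; fromℕ<)
open import Data.Fin.Properties using () renaming (_≟_ to _≟ᶠ_)
open import Data.Product using (Σ; ∃; _×_; _,_)
open import Data.Vec.Functional using (foldr)
open import Relation.Nullary using (¬_; yes; no)
open import Relation.Binary.PropositionalEquality using (_≡_; _≢_)
open import Algebra.Structures using (IsCommutativeRing)
open import Function.Bundles using (_↔_)

record FiniteField (N : ℕ) : Set₁ where
  infixl 7 _*_
  infixl 6 _+_
  field
    Carrier : Set
    _+_ _*_ : Carrier → Carrier → Carrier
    -_      : Carrier → Carrier
    0# 1#   : Carrier
    isCommutativeRing : IsCommutativeRing (_≡_ {A = Carrier}) _+_ _*_ -_ 0# 1#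
    0≢1     : 0# ≢ 1#
    inverse : ∀ x → x ≢ 0# → Σ Carrier λ y → x * y ≡ 1#
    card    : Carrier ↔ Fin N

-- Linearised polynomials over F = F_{q^n} of q-degree < n, i.e. V = End_{F_q}(F_{q^n}).
module LinearisedPolys {N : ℕ} (F : FiniteField N) (q n : ℕ) {{nz : NonZero n}} where
  open FiniteField F

  _^_ : Carrier → ℕ → Carrier
  x ^ zero  = 1#
  x ^ suc k = x * (x ^ k)

  -- f(x) = Σ_{i<n} f_i x^{q^i}, represented by its coefficient vector
  LinPoly : Set
  LinPoly = Fin n → Carrier

  sumF : (Fin n → Carrier) → Carrier
  sumF v = foldr _+_ 0# v

  eval : LinPoly → Carrier → Carrier
  eval f x = sumF λ i → f i * (x ^ (q ℕ.^ toℕ i))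

  _≗ᴸ_ : LinPoly → LinPoly → Set
  f ≗ᴸ g = ∀ i → f i ≡ g i

  zeroL : LinPoly
  zeroL = λ _ → 0#

  _+ᴸ_ : LinPoly → LinPoly → LinPoly
  (f +ᴸ g) i = f i + g i

  _·ᴸ_ : Carrier → LinPoly → LinPoly
  (α ·ᴸ f) i = α * f i

  sub-mod : Fin n → Fin n → Fin n
  sub-mod k i = fromℕ< (m%n<n (toℕ k ℕ.+ (n ℕ.∸ toℕ i)) n)

  -- composition f ∘ g = f(g(x)) mod (x^{q^n} - x):
  -- f(g(x)) = Σ_i Σ_j f_i g_j^{q^i} x^{q^{i+j}}, and x^{q^{i+j}} ≡ x^{q^{(i+j) mod n}},
  -- so the coefficient of x^{q^k} is Σ_i f_i (g_{(k-i) mod n})^{q^i}.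
  _∘ᴸ_ : LinPoly → LinPoly → LinPoly
  (f ∘ᴸ g) k = sumF λ i → f i * (g (sub-mod k i) ^ (q ℕ.^ toℕ i))

  monomial : Fin n → LinPoly
  monomial m i with i ≟ᶠ m
  ... | yes _ = 1#
  ... | no  _ = 0#

  Invertible : LinPoly → Set
  Invertible g = ∀ x → eval g x ≡ 0# → x ≡ 0#

  record IsSubspace (C : LinPoly → Set) : Set where
    field
      respects : ∀ {f g} → f ≗ᴸ g → C f → C g
      has-zero : C zeroL
      closed-+ : ∀ {f g} → C f → C g → C (f +ᴸ g)
      closed-· : ∀ α {f} → C f → C (α ·ᴸ f)

  _∘ˢ_ : LinPoly → (LinPoly → Set) → (LinPoly → Set)
  (g ∘ˢ C) h = ∃ λ f → C f × (h ≗ᴸ (g ∘ᴸ f))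

  _≐_ : (LinPoly → Set) → (LinPoly → Set) → Set
  A ≐ B = (∀ h → A h → B h) × (∀ h → B h → A h)

-- For f ∈ C the subspace g ∘ C contains every g ∘ (β f), and
-- (g ∘ (β f))ₖ = Σᵢ β^{qⁱ} gᵢ f_{k-i}^{qⁱ}.  Weighting by β^{N-1-q^m} (N = qⁿ) and summing over β ∈ F
-- isolates the term i = m: the power sum Σ_β β^{N-1-q^m+qⁱ} is 0 for i ≠ m, since some γ ≠ 0 has
-- γ^{qⁱ} ≠ γ^{q^m} (a polynomial of degree < N cannot vanish on F), and it is -1 for i = m.  As gₘ ≠ 0
-- this gives x^{q^m} ∘ C ⊆ g ∘ C.  Conversely x^{q^m} ∘ − is inverted by x^{q^{n-m}} ∘ −, so every
-- f ∈ C has a preimage in C under Ψ = x^{q^{n-m}} ∘ g ∘ −; C being finite, Ψ then maps C into itself,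
-- and g ∘ f = x^{q^m} ∘ Ψ f.

module Submission where

open import Defs
open import Data.Nat using (ℕ; _≤_; NonZero)
open import Data.Fin using (Fin)
open import Relation.Binary.PropositionalEquality using (_≢_)

open import Level using (0ℓ)
open import Data.Empty using (⊥-elim)
open import Data.Nat as ℕ using (zero; suc; _<_; _∸_; z≤n; s≤s)
import Data.Nat.Properties as ℕ
open import Data.Nat.DivMod using (_%_; m%n<n; %-distribˡ-+; m%n%n≡m%n; n%n≡0; %-remove-+ʳ; m<n⇒m%n≡m)
open import Data.Nat.Divisibility using (_∣_; divides; m%n≡0⇒n∣m; ∣m+n∣m⇒∣n; ∣m∣n⇒∣m+n; ∣-refl)
open import Data.Nat.GeneralisedArithmetic using (iterate)
open import Data.Fin using (zero; suc; toℕ; fromℕ<; punchIn; funToFin; finToFun)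
import Data.Fin.Properties as Fin
open import Data.Product using (Σ; ∃; _×_; _,_; proj₁; proj₂)
open import Data.Vec as Vec using (Vec; []; _∷_)
open import Data.Vec.Functional using (Vector; replicate)
open import Function using (_∘_; _↔_; Inverse; mk↔ₛ′)
open import Function.Construct.Composition using (_↔-∘_)
open import Function.Construct.Symmetry using (↔-sym)
open import Function.Definitions using (Injective)
open import Relation.Nullary using (¬_; Dec; yes; no; map′)
open import Relation.Nullary.Decidable using (decidable-stable)
open import Relation.Unary using (Pred)
open import Relation.Binary.Bundles using (Setoid)
open import Relation.Binary.Core using (_Preserves_⟶_)
open import Relation.Binary.Definitions using (_Respects_; tri<; tri≈; tri>)
open import Relation.Binary.PropositionalEquality
  using (_≡_; _≗_; refl; sym; trans; cong; cong₂; subst; _→-setoid_; module ≡-Reasoning)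
import Relation.Binary.Reasoning.Setoid as SetoidReasoning
open import Algebra.Bundles using (CommutativeMonoid; CommutativeRing)
import Algebra.Properties.CommutativeMonoid.Sum as MonoidSum
import Algebra.Properties.CommutativeSemigroup as CommutativeSemigroupProperties
import Algebra.Properties.CommutativeSemiring.Exp as CommutativeSemiringExp
import Algebra.Properties.Group as GroupProperties
import Algebra.Properties.Semiring.Exp as SemiringExp
import Algebra.Properties.Semiring.Sum as SemiringSum
import Algebra.Solver.Ring.NaturalCoefficients.Default as SemiringSolver

module _ {c ℓ} (M : CommutativeMonoid c ℓ) where
  open CommutativeMonoid M using (Carrier; _≈_; _∙_; ε; ∙-congˡ; identityʳ) renaming (trans to ≈-trans)
  open MonoidSum M using (sum; sum-remove; sum-cong-≋; sum-replicate-zero)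

  sum-constant-except : ∀ {m} (v : Vector Carrier m) i {x} → (∀ j → j ≢ i → v j ≈ x) →
                        sum v ≈ v i ∙ sum (replicate (ℕ.pred m) x)
  sum-constant-except {suc m} v i v≈x =
    ≈-trans (sum-remove v) (∙-congˡ (sum-cong-≋ λ j → v≈x (punchIn i j) (Fin.punchInᵢ≢i i j)))

  sum-single : ∀ {m} (v : Vector Carrier m) i → (∀ j → j ≢ i → v j ≈ ε) → sum v ≈ v i
  sum-single {m} v i v≈ε =
    ≈-trans (sum-constant-except v i v≈ε) (≈-trans (∙-congˡ (sum-replicate-zero (ℕ.pred m))) (identityʳ (v i)))

module _ {a ℓ} (S : Setoid a ℓ) where
  open Setoid S using (_≈_) renaming (Carrier to A; refl to ≈-refl; sym to ≈-sym; trans to ≈-trans)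
  open SetoidReasoning S

  -- Follow preimages x = x₀ ← x₁ ← x₂ ← ⋯ inside P.  Pigeonhole gives xᵢ ≈ xᵢ₊ₛ₊₁, and applying
  -- Ψ i times yields x ≈ xₛ₊₁, so Ψ x ≈ xₛ lies in P.
  onto⇒closed : ∀ {p K} {P : Pred A p} {Ψ : A → A} (code : A → Fin K) → Injective _≈_ _≡_ code →
                P Respects _≈_ → Ψ Preserves _≈_ ⟶ _≈_ → (∀ {x} → P x → ∃ λ y → P y × Ψ y ≈ x) →
                ∀ {x} → P x → P (Ψ x)
  onto⇒closed {K = K} {P} {Ψ} code code-injective P-resp Ψ-cong preimage {x} Px =
    P-resp (≈-sym Ψx≈xₛ) (proj₂ (chain s))
    where
    chain : ℕ → Σ A P
    chain zero    = x , Px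
    chain (suc j) = let y , Py , _ = preimage (proj₂ (chain j)) in y , Py

    xs : ℕ → A
    xs = proj₁ ∘ chain

    Ψ-chain : ∀ j → Ψ (xs (suc j)) ≈ xs j
    Ψ-chain j = proj₂ (proj₂ (preimage (proj₂ (chain j))))

    iterate-cong : ∀ i {y z} → y ≈ z → iterate Ψ y i ≈ iterate Ψ z i
    iterate-cong zero    y≈z = y≈z
    iterate-cong (suc i) y≈z = iterate-cong i (Ψ-cong y≈z)

    iterate-chain : ∀ i j → iterate Ψ (xs (i ℕ.+ j)) i ≈ xs j
    iterate-chain zero    j = ≈-refl
    iterate-chain (suc i) j = ≈-trans (iterate-cong i (Ψ-chain (i ℕ.+ j))) (iterate-chain i j)

    collision = Fin.pigeonhole (ℕ.n<1+n K) (code ∘ xs ∘ toℕ)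
    i = toℕ (proj₁ collision)
    j = toℕ (proj₁ (proj₂ collision))
    s = j ∸ suc i
    i+1+s≡j : i ℕ.+ suc s ≡ j
    i+1+s≡j = trans (ℕ.+-suc i s) (ℕ.m+[n∸m]≡n (proj₁ (proj₂ (proj₂ collision))))

    x≈xₛ₊₁ : x ≈ xs (suc s)
    x≈xₛ₊₁ = begin
      x                               ≈⟨ iterate-chain i 0 ⟨
      iterate Ψ (xs (i ℕ.+ 0)) i      ≡⟨ cong (λ k → iterate Ψ (xs k) i) (ℕ.+-identityʳ i) ⟩
      iterate Ψ (xs i) i              ≈⟨ iterate-cong i (code-injective (proj₂ (proj₂ (proj₂ collision)))) ⟩
      iterate Ψ (xs j) i              ≡⟨ cong (λ k → iterate Ψ (xs k) i) i+1+s≡j ⟨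
      iterate Ψ (xs (i ℕ.+ suc s)) i  ≈⟨ iterate-chain i (suc s) ⟩
      xs (suc s)                      ∎

    Ψx≈xₛ : Ψ x ≈ xs s
    Ψx≈xₛ = ≈-trans (Ψ-cong x≈xₛ₊₁) (Ψ-chain s)

[m%d+n]%d≡[m+n]%d : ∀ m n d .{{_ : NonZero d}} → (m % d ℕ.+ n) % d ≡ (m ℕ.+ n) % d
[m%d+n]%d≡[m+n]%d m n d = begin
  (m % d ℕ.+ n) % d          ≡⟨ %-distribˡ-+ (m % d) n d ⟩
  (m % d % d ℕ.+ n % d) % d  ≡⟨ cong (λ r → (r ℕ.+ n % d) % d) (m%n%n≡m%n m d) ⟩
  (m % d ℕ.+ n % d) % d      ≡⟨ %-distribˡ-+ m n d ⟨
  (m ℕ.+ n) % d              ∎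
  where open ≡-Reasoning

i≢j⇒1<n : ∀ {M} {i j : Fin M} → i ≢ j → 1 < M
i≢j⇒1<n {suc zero}    {zero} {zero} i≢j = ⊥-elim (i≢j refl)
i≢j⇒1<n {suc (suc _)} _                = s≤s (s≤s z≤n)

module FiniteFieldProperties {N : ℕ} (F : FiniteField N) where
  open FiniteField F using (isCommutativeRing; 0≢1; inverse; card)

  commutativeRing : CommutativeRing 0ℓ 0ℓ
  commutativeRing = record { isCommutativeRing = isCommutativeRing }

  open CommutativeRing commutativeRing public
    hiding (refl; sym; trans; reflexive; isEquivalence; setoid; zero)
  open SemiringExp semiring public using (_^_; ^-homo-*; ^-assocʳ)
  open CommutativeSemiringExp commutativeSemiring public using (^-distrib-*)
  open SemiringSolver commutativeSemiring using (solve; _:+_; _:*_; _:=_)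
  open CommutativeSemigroupProperties *-commutativeSemigroup public
    using () renaming (x∙yz≈y∙xz to x*yz≡y*xz)
  open GroupProperties +-group using (identityˡ-unique; identityʳ-unique; //-rightDividesˡ; //-rightDividesʳ)
  module Sum = SemiringSum semiring
  module Product = MonoidSum *-commutativeMonoid

  open Inverse card public using ()
    renaming (to to index; from to element; strictlyInverseʳ to element-index; strictlyInverseˡ to index-element)

  index-injective : Injective _≡_ _≡_ index
  index-injective {x} {y} eq = trans (sym (element-index x)) (trans (cong element eq) (element-index y))

  infix 4 _≟_
  _≟_ : (x y : Carrier) → Dec (x ≡ y)
  x ≟ y = map′ index-injective (cong index) (index x Fin.≟ index y)

  1<N : 1 < N
  1<N = i≢j⇒1<n {i = index 0#} (0≢1 ∘ index-injective)

  open ≡-Reasoning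

  1≢0 : 1# ≢ 0#
  1≢0 = 0≢1 ∘ sym

  x⁻¹ : ∀ {x} → x ≢ 0# → Carrier
  x⁻¹ x≢0 = proj₁ (inverse _ x≢0)

  x*x⁻¹≡1 : ∀ {x} (x≢0 : x ≢ 0#) → x * x⁻¹ x≢0 ≡ 1#
  x*x⁻¹≡1 x≢0 = proj₂ (inverse _ x≢0)

  x*[x⁻¹*y]≡y : ∀ {x} (x≢0 : x ≢ 0#) y → x * (x⁻¹ x≢0 * y) ≡ y
  x*[x⁻¹*y]≡y {x} x≢0 y = begin
    x * (x⁻¹ x≢0 * y)  ≡⟨ sym (*-assoc x _ y) ⟩
    x * x⁻¹ x≢0 * y    ≡⟨ cong (_* y) (x*x⁻¹≡1 x≢0) ⟩
    1# * y             ≡⟨ *-identityˡ y ⟩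
    y                  ∎

  x⁻¹*[x*y]≡y : ∀ {x} (x≢0 : x ≢ 0#) y → x⁻¹ x≢0 * (x * y) ≡ y
  x⁻¹*[x*y]≡y {x} x≢0 y = trans (x*yz≡y*xz _ x y) (x*[x⁻¹*y]≡y x≢0 y)

  *-cancelˡ-≢0 : ∀ {x y z} → x ≢ 0# → x * y ≡ x * z → y ≡ z
  *-cancelˡ-≢0 {x} {y} {z} x≢0 eq = begin
    y                  ≡⟨ sym (x⁻¹*[x*y]≡y x≢0 y) ⟩
    x⁻¹ x≢0 * (x * y)  ≡⟨ cong (x⁻¹ x≢0 *_) eq ⟩
    x⁻¹ x≢0 * (x * z)  ≡⟨ x⁻¹*[x*y]≡y x≢0 z ⟩
    z                  ∎

  *-cancelʳ-≢0 : ∀ {x y z} → z ≢ 0# → x * z ≡ y * z → x ≡ y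
  *-cancelʳ-≢0 {x} {y} {z} z≢0 eq = *-cancelˡ-≢0 z≢0 (trans (*-comm z x) (trans eq (*-comm y z)))

  x*y≢0 : ∀ {x y} → x ≢ 0# → y ≢ 0# → x * y ≢ 0#
  x*y≢0 {x} x≢0 y≢0 xy≡0 = y≢0 (*-cancelˡ-≢0 x≢0 (trans xy≡0 (sym (zeroʳ x))))

  x^k≢0 : ∀ {x} k → x ≢ 0# → x ^ k ≢ 0#
  x^k≢0 zero    x≢0 = 1≢0
  x^k≢0 (suc k) x≢0 = x*y≢0 x≢0 (x^k≢0 k x≢0)

  0^k≡0 : ∀ {k} → 0 < k → 0# ^ k ≡ 0#
  0^k≡0 {suc k} _ = zeroˡ _

  ∏-≢0 : ∀ {M} (v : Vector Carrier M) → (∀ j → v j ≢ 0#) → Product.sum v ≢ 0#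
  ∏-≢0 {zero}  v v≢0 = 1≢0
  ∏-≢0 {suc M} v v≢0 = x*y≢0 (v≢0 zero) (∏-≢0 (v ∘ suc) (v≢0 ∘ suc))

  ∑ᶠ ∏ᶠ : (Carrier → Carrier) → Carrier
  ∑ᶠ h = Sum.sum (h ∘ element)
  ∏ᶠ h = Product.sum (h ∘ element)

  module _ (σ : Carrier ↔ Carrier) where
    private
      π : Fin N ↔ Fin N
      π = card ↔-∘ (σ ↔-∘ ↔-sym card)

    ∑ᶠ-reindex : ∀ h → ∑ᶠ h ≡ ∑ᶠ (h ∘ Inverse.to σ)
    ∑ᶠ-reindex h = trans (Sum.sum-permute (h ∘ element) π)
                         (Sum.sum-cong-≗ λ j → cong h (element-index (Inverse.to σ (element j))))

    ∏ᶠ-reindex : ∀ h → ∏ᶠ h ≡ ∏ᶠ (h ∘ Inverse.to σ)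
    ∏ᶠ-reindex h = trans (Product.sum-permute (h ∘ element) π)
                         (Product.sum-cong-≗ λ j → cong h (element-index (Inverse.to σ (element j))))

  +-translation : Carrier → Carrier ↔ Carrier
  +-translation a = mk↔ₛ′ (_+ a) (_- a) (//-rightDividesˡ a) (//-rightDividesʳ a)

  *-scaling : ∀ {γ} → γ ≢ 0# → Carrier ↔ Carrier
  *-scaling γ≢0 = mk↔ₛ′ (_ *_) (x⁻¹ γ≢0 *_) (x*[x⁻¹*y]≡y γ≢0) (x⁻¹*[x*y]≡y γ≢0)

  ∑ᶠ-1≡0 : ∑ᶠ (λ _ → 1#) ≡ 0#
  ∑ᶠ-1≡0 = identityʳ-unique (∑ᶠ (λ x → x)) _ (sym (begin
    ∑ᶠ (λ x → x)                      ≡⟨ ∑ᶠ-reindex (+-translation 1#) (λ x → x) ⟩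
    ∑ᶠ (_+ 1#)                        ≡⟨ Sum.∑-distrib-+ element (λ _ → 1#) ⟩
    ∑ᶠ (λ x → x) + ∑ᶠ (λ _ → 1#)      ∎))

  ifZero : Carrier → Carrier → Carrier → Carrier
  ifZero x a b with x ≟ 0#
  ... | yes _ = a
  ... | no  _ = b

  ifZero-≡0 : ∀ {x} → x ≡ 0# → ∀ a b → ifZero x a b ≡ a
  ifZero-≡0 {x} x≡0 a b with x ≟ 0#
  ... | yes _   = refl
  ... | no x≢0 = ⊥-elim (x≢0 x≡0)

  ifZero-≢0 : ∀ {x} → x ≢ 0# → ∀ a b → ifZero x a b ≡ b
  ifZero-≢0 {x} x≢0 a b with x ≟ 0#
  ... | yes x≡0 = ⊥-elim (x≢0 x≡0)
  ... | no _    = refl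

  private
    element≢0 : ∀ {j} → j ≢ index 0# → element j ≢ 0#
    element≢0 {j} j≢ e = j≢ (trans (sym (index-element j)) (cong index e))

    ifZero-element0 : ∀ a b → ifZero (element (index 0#)) a b ≡ a
    ifZero-element0 = ifZero-≡0 (element-index 0#)

  ∑ᶠ-ifZero : ∀ a → ∑ᶠ (λ x → ifZero x a 0#) ≡ a
  ∑ᶠ-ifZero a = trans (sum-single +-commutativeMonoid _ (index 0#) λ j j≢ → ifZero-≢0 (element≢0 j≢) a 0#)
                      (ifZero-element0 a 0#)

  ∏ᶠ-ifZero : ∀ c → ∏ᶠ (λ x → ifZero x 1# c) ≡ c ^ (N ∸ 1)
  ∏ᶠ-ifZero c = begin
    ∏ᶠ (λ x → ifZero x 1# c)
      ≡⟨ sum-constant-except *-commutativeMonoid _ (index 0#) (λ j j≢ → ifZero-≢0 (element≢0 j≢) 1# c) ⟩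
    ifZero (element (index 0#)) 1# c * Product.sum (replicate (ℕ.pred N) c)
      ≡⟨ cong₂ _*_ (ifZero-element0 1# c) (Product.sum-replicate (ℕ.pred N) {c}) ⟩
    1# * c ^ (N ∸ 1)
      ≡⟨ *-identityˡ _ ⟩
    c ^ (N ∸ 1) ∎

  -- Lagrange and Fermat

  0↦1 : Carrier → Carrier
  0↦1 x = ifZero x 1# x

  0↦1-≢0 : ∀ x → 0↦1 x ≢ 0#
  0↦1-≢0 x with x ≟ 0#
  ... | yes _   = 1≢0
  ... | no x≢0 = x≢0

  0↦1-* : ∀ {γ} → γ ≢ 0# → ∀ x → 0↦1 (γ * x) ≡ ifZero x 1# γ * 0↦1 x
  0↦1-* {γ} γ≢0 x with x ≟ 0#
  ... | yes x≡0 = trans (ifZero-≡0 (trans (cong (γ *_) x≡0) (zeroʳ γ)) 1# _) (sym (*-identityˡ 1#))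
  ... | no x≢0  = ifZero-≢0 (x*y≢0 γ≢0 x≢0) 1# _

  -- Lagrange for the multiplicative group: compare ∏ₓ 0↦1 x with its reindexing along x ↦ γ x.
  x^[N∸1]≡1 : ∀ {x} → x ≢ 0# → x ^ (N ∸ 1) ≡ 1#
  x^[N∸1]≡1 {γ} γ≢0 = sym (*-cancelʳ-≢0 (∏-≢0 _ (0↦1-≢0 ∘ element)) (begin
    1# * P                                ≡⟨ *-identityˡ P ⟩
    P                                     ≡⟨ ∏ᶠ-reindex (*-scaling γ≢0) 0↦1 ⟩
    ∏ᶠ (λ x → 0↦1 (γ * x))                ≡⟨ Product.sum-cong-≗ (0↦1-* γ≢0 ∘ element) ⟩
    ∏ᶠ (λ x → ifZero x 1# γ * 0↦1 x)      ≡⟨ Product.∑-distrib-+ (λ j → ifZero (element j) 1# γ) (0↦1 ∘ element) ⟩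
    ∏ᶠ (λ x → ifZero x 1# γ) * P          ≡⟨ cong (_* P) (∏ᶠ-ifZero γ) ⟩
    γ ^ (N ∸ 1) * P                       ∎))
    where P = ∏ᶠ 0↦1

  1+[N∸1]≡N : suc (N ∸ 1) ≡ N
  1+[N∸1]≡N = ℕ.m+[n∸m]≡n (ℕ.<⇒≤ 1<N)

  x^N≡x : ∀ x → x ^ N ≡ x
  x^N≡x x with x ≟ 0#
  ... | yes refl = 0^k≡0 (ℕ.<-trans (s≤s z≤n) 1<N)
  ... | no x≢0   = begin
    x ^ N              ≡⟨ cong (x ^_) (sym 1+[N∸1]≡N) ⟩
    x * x ^ (N ∸ 1)    ≡⟨ cong (x *_) (x^[N∸1]≡1 x≢0) ⟩
    x * 1#             ≡⟨ *-identityʳ x ⟩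
    x                  ∎

  x^[N^t]≡x : ∀ t x → x ^ (N ℕ.^ t) ≡ x
  x^[N^t]≡x zero    x = *-identityʳ x
  x^[N^t]≡x (suc t) x = begin
    x ^ (N ℕ.* N ℕ.^ t)  ≡⟨ sym (^-assocʳ x N (N ℕ.^ t)) ⟩
    (x ^ N) ^ (N ℕ.^ t)  ≡⟨ cong (_^ (N ℕ.^ t)) (x^N≡x x) ⟩
    x ^ (N ℕ.^ t)        ≡⟨ x^[N^t]≡x t x ⟩
    x                    ∎

  -- Counting roots of polynomials

  -- A vector cs = (c₀, …, c_{d-1}) encodes the monic polynomial
  -- c₀ + c₁ x + ⋯ + c_{d-1} x^{d-1} + x^d of degree d.
  monic : ∀ {d} → Vec Carrier d → Carrier → Carrier
  monic []       x = 1#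
  monic (c ∷ cs) x = c + x * monic cs x

  -- Division by x - r, stated without subtraction.
  monic-divide : ∀ {d} (cs : Vec Carrier (suc d)) r →
                 Σ (Vec Carrier d) λ ds → ∀ x → monic cs x + r * monic ds x ≡ x * monic ds x + monic cs r
  monic-divide (c ∷ []) r =
    [] , λ x → solve 3 (λ c r x → c :+ x :* 1ᴱ :+ r :* 1ᴱ := x :* 1ᴱ :+ (c :+ r :* 1ᴱ)) refl c r x
    where 1ᴱ = SemiringSolver.con 1
  monic-divide (c ∷ cs@(_ ∷ _)) r with monic-divide cs r
  ... | ds , division = (monic cs r ∷ ds) , λ x → begin
    c + x * monic cs x + r * (monic cs r + x * monic ds x)  ≡⟨ lhs c r x (monic cs x) (monic cs r) (monic ds x) ⟩
    c + r * monic cs r + x * (monic cs x + r * monic ds x)  ≡⟨ cong (λ y → c + r * monic cs r + x * y) (division x) ⟩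
    c + r * monic cs r + x * (x * monic ds x + monic cs r)  ≡⟨ rhs c r x (monic cs r) (monic ds x) ⟩
    x * (monic cs r + x * monic ds x) + (c + r * monic cs r) ∎
    where
    lhs : ∀ c r x p pr q → c + x * p + r * (pr + x * q) ≡ c + r * pr + x * (p + r * q)
    lhs = solve 6 (λ c r x p pr q → c :+ x :* p :+ r :* (pr :+ x :* q) := c :+ r :* pr :+ x :* (p :+ r :* q)) refl
    rhs : ∀ c r x pr q → c + r * pr + x * (x * q + pr) ≡ x * (pr + x * q) + (c + r * pr)
    rhs = solve 5 (λ c r x pr q → c :+ r :* pr :+ x :* (x :* q :+ pr) := x :* (pr :+ x :* q) :+ (c :+ r :* pr)) refl

  monic-roots≤degree : ∀ {d k} (cs : Vec Carrier d) (ρ : Fin k → Carrier) → Injective _≡_ _≡_ ρ →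
                       (∀ j → monic cs (ρ j) ≡ 0#) → k ≤ d
  monic-roots≤degree {k = zero}  cs       ρ ρ-inj roots = z≤n
  monic-roots≤degree {k = suc k} []       ρ ρ-inj roots = ⊥-elim (1≢0 (roots zero))
  monic-roots≤degree {k = suc k} (c ∷ cs) ρ ρ-inj roots with monic-divide (c ∷ cs) (ρ zero)
  ... | ds , division = s≤s (monic-roots≤degree ds (ρ ∘ suc) (Fin.suc-injective ∘ ρ-inj) quotient-roots)
    where
    quotient-roots : ∀ j → monic ds (ρ (suc j)) ≡ 0#
    quotient-roots j = decidable-stable (q ≟ 0#) λ q≢0 →
      Fin.0≢1+n (ρ-inj (*-cancelʳ-≢0 q≢0 (begin
        ρ zero * q                ≡⟨ sym (+-identityˡ _) ⟩
        0# + ρ zero * q           ≡⟨ cong (_+ ρ zero * q) (sym (roots (suc j))) ⟩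
        monic (c ∷ cs) x + ρ zero * q ≡⟨ division x ⟩
        x * q + monic (c ∷ cs) (ρ zero) ≡⟨ cong (x * q +_) (roots zero) ⟩
        x * q + 0#                ≡⟨ +-identityʳ _ ⟩
        x * q                     ∎)))
      where
      x = ρ (suc j)
      q = monic ds x

  monic-zeros : ∀ d x → monic (Vec.replicate d 0#) x ≡ x ^ d
  monic-zeros zero    x = refl
  monic-zeros (suc d) x = trans (+-identityˡ _) (cong (x *_) (monic-zeros d x))

  xᵈ-xᵘ : ∀ {u d} → u < d → Vec Carrier d
  xᵈ-xᵘ {zero}  {suc d} _         = - 1# ∷ Vec.replicate d 0#
  xᵈ-xᵘ {suc u} {suc d} (s≤s u<d) = 0# ∷ xᵈ-xᵘ u<d

  monic-xᵈ-xᵘ : ∀ {u d} (u<d : u < d) x → monic (xᵈ-xᵘ u<d) x + x ^ u ≡ x ^ d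
  monic-xᵈ-xᵘ {zero} {suc d} _ x = begin
    - 1# + x * monic (Vec.replicate d 0#) x + 1#  ≡⟨ cong (_+ 1#) (+-comm (- 1#) _) ⟩
    x * monic (Vec.replicate d 0#) x - 1# + 1#    ≡⟨ //-rightDividesˡ 1# _ ⟩
    x * monic (Vec.replicate d 0#) x              ≡⟨ cong (x *_) (monic-zeros d x) ⟩
    x * x ^ d                                     ∎
  monic-xᵈ-xᵘ {suc u} {suc d} (s≤s u<d) x = begin
    0# + x * monic (xᵈ-xᵘ u<d) x + x * x ^ u  ≡⟨ cong (_+ x * x ^ u) (+-identityˡ _) ⟩
    x * monic (xᵈ-xᵘ u<d) x + x * x ^ u       ≡⟨ sym (distribˡ x _ _) ⟩
    x * (monic (xᵈ-xᵘ u<d) x + x ^ u)         ≡⟨ cong (x *_) (monic-xᵈ-xᵘ u<d x) ⟩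
    x * x ^ d                                 ∎

  element-injective : Injective _≡_ _≡_ element
  element-injective {i} {j} eq = trans (sym (index-element i)) (trans (cong index eq) (index-element j))

  ^-separates< : ∀ {u d} → u < d → d < N → ∃ λ γ → γ ^ d ≢ γ ^ u
  ^-separates< {u} {d} u<d d<N
    with Fin.¬∀⟶∃¬ N (λ j → element j ^ d ≡ element j ^ u) (λ j → element j ^ d ≟ element j ^ u) too-many-roots
    where
    too-many-roots : ¬ (∀ j → element j ^ d ≡ element j ^ u)
    too-many-roots roots = ℕ.<⇒≱ d<N (monic-roots≤degree (xᵈ-xᵘ u<d) element element-injective λ j →
      identityˡ-unique _ _ (trans (monic-xᵈ-xᵘ u<d (element j)) (roots j)))
  ... | j , γᵈ≢γᵘ = element j , γᵈ≢γᵘ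

  ^-separates : ∀ {u v} → u < N → v < N → u ≢ v → ∃ λ γ → γ ^ u ≢ γ ^ v
  ^-separates {u} {v} u<N v<N u≢v with ℕ.<-cmp u v
  ... | tri< u<v _ _ = let γ , γᵛ≢γᵘ = ^-separates< u<v v<N in γ , γᵛ≢γᵘ ∘ sym
  ... | tri≈ _ u≡v _ = ⊥-elim (u≢v u≡v)
  ... | tri> _ _ v<u = ^-separates< v<u u<N

  -- Power sums

  ∑ᶠ-^≡0 : ∀ {γ a} → γ ≢ 0# → γ ^ a ≢ 1# → ∑ᶠ (_^ a) ≡ 0#
  ∑ᶠ-^≡0 {γ} {a} γ≢0 γᵃ≢1 = decidable-stable (S ≟ 0#) λ S≢0 → γᵃ≢1 (*-cancelʳ-≢0 S≢0 (begin
    γ ^ a * S                   ≡⟨ Sum.*-distribˡ-sum (γ ^ a) ((_^ a) ∘ element) ⟩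
    ∑ᶠ (λ x → γ ^ a * x ^ a)    ≡⟨ Sum.sum-cong-≗ (λ j → sym (^-distrib-* γ (element j) a)) ⟩
    ∑ᶠ (λ x → (γ * x) ^ a)      ≡⟨ sym (∑ᶠ-reindex (*-scaling γ≢0) (_^ a)) ⟩
    S                           ≡⟨ sym (*-identityˡ S) ⟩
    1# * S                      ∎))
    where S = ∑ᶠ (_^ a)

  x^[N∸1]+[x≟0]≡1 : ∀ x → x ^ (N ∸ 1) + ifZero x 1# 0# ≡ 1#
  x^[N∸1]+[x≟0]≡1 x with x ≟ 0#
  ... | yes refl = trans (cong (_+ 1#) (0^k≡0 (ℕ.<⇒≤pred 1<N))) (+-identityˡ 1#)
  ... | no x≢0   = trans (+-identityʳ _) (x^[N∸1]≡1 x≢0)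

  ∑ᶠ-^[N∸1]≢0 : ∑ᶠ (_^ (N ∸ 1)) ≢ 0#
  ∑ᶠ-^[N∸1]≢0 S≡0 = 1≢0 (begin
    1#                                               ≡⟨ sym (+-identityˡ 1#) ⟩
    0# + 1#                                          ≡⟨ cong₂ _+_ (sym S≡0) (sym (∑ᶠ-ifZero 1#)) ⟩
    ∑ᶠ (_^ (N ∸ 1)) + ∑ᶠ (λ x → ifZero x 1# 0#)      ≡⟨ sym (Sum.∑-distrib-+ ((_^ (N ∸ 1)) ∘ element) _) ⟩
    ∑ᶠ (λ x → x ^ (N ∸ 1) + ifZero x 1# 0#)          ≡⟨ Sum.sum-cong-≗ (x^[N∸1]+[x≟0]≡1 ∘ element) ⟩
    ∑ᶠ (λ _ → 1#)                                    ≡⟨ ∑ᶠ-1≡0 ⟩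
    0#                                               ∎)

  ∑ᶠ-^-orthogonal : ∀ {u v} → 0 < u → 0 < v → u < N → v < N → u ≢ v →
                    ∑ᶠ (λ x → x ^ (N ∸ 1 ∸ u) * x ^ v) ≡ 0#
  ∑ᶠ-^-orthogonal {u} {v} 0<u 0<v u<N v<N u≢v =
    trans (Sum.sum-cong-≗ λ j → sym (^-homo-* (element j) e v)) (∑ᶠ-^≡0 {a = e ℕ.+ v} γ≢0 γᵉ⁺ᵛ≢1)
    where
    e = N ∸ 1 ∸ u
    γ = proj₁ (^-separates u<N v<N u≢v)
    γᵘ≢γᵛ = proj₂ (^-separates u<N v<N u≢v)
    γ≢0 : γ ≢ 0#
    γ≢0 γ≡0 = γᵘ≢γᵛ (begin
      γ ^ u   ≡⟨ cong (_^ u) γ≡0 ⟩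
      0# ^ u  ≡⟨ 0^k≡0 0<u ⟩
      0#      ≡⟨ sym (0^k≡0 0<v) ⟩
      0# ^ v  ≡⟨ cong (_^ v) (sym γ≡0) ⟩
      γ ^ v   ∎)
    γᵉ⁺ᵛ≢1 : γ ^ (e ℕ.+ v) ≢ 1#
    γᵉ⁺ᵛ≢1 γᵉ⁺ᵛ≡1 = γᵘ≢γᵛ (*-cancelˡ-≢0 (x^k≢0 e γ≢0) (begin
      γ ^ e * γ ^ u    ≡⟨ sym (^-homo-* γ e u) ⟩
      γ ^ (e ℕ.+ u)    ≡⟨ cong (γ ^_) (ℕ.m∸n+n≡m (ℕ.<⇒≤pred u<N)) ⟩
      γ ^ (N ∸ 1)      ≡⟨ x^[N∸1]≡1 γ≢0 ⟩
      1#               ≡⟨ sym γᵉ⁺ᵛ≡1 ⟩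
      γ ^ (e ℕ.+ v)    ≡⟨ ^-homo-* γ e v ⟩
      γ ^ e * γ ^ v    ∎))

  ∑ᶠ-^-diagonal : ∀ {u} → u < N → ∑ᶠ (λ x → x ^ (N ∸ 1 ∸ u) * x ^ u) ≢ 0#
  ∑ᶠ-^-diagonal {u} u<N S≡0 = ∑ᶠ-^[N∸1]≢0 (trans (Sum.sum-cong-≗ λ j → x^[N∸1]≡x^e*x^u (element j)) S≡0)
    where
    x^[N∸1]≡x^e*x^u : ∀ x → x ^ (N ∸ 1) ≡ x ^ (N ∸ 1 ∸ u) * x ^ u
    x^[N∸1]≡x^e*x^u x = trans (cong (x ^_) (sym (ℕ.m∸n+n≡m (ℕ.<⇒≤pred u<N)))) (^-homo-* x (N ∸ 1 ∸ u) u)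

  encode : ∀ {k} → (Fin k → Carrier) → Fin (N ℕ.^ k)
  encode f = funToFin (index ∘ f)

  encode-injective : ∀ {k} → Injective _≗_ _≡_ (encode {k})
  encode-injective {x = f} {g} eq i = index-injective (begin
    index (f i)                ≡⟨ Fin.finToFun-funToFin (index ∘ f) i ⟨
    finToFun (encode f) i      ≡⟨ cong (λ c → finToFun c i) eq ⟩
    finToFun (encode g) i      ≡⟨ Fin.finToFun-funToFin (index ∘ g) i ⟩
    index (g i)                ∎)

module LinearisedCompositions (q n : ℕ) {{_ : NonZero n}} (1<q : 1 < q) (F : FiniteField (q ℕ.^ n)) where
  open FiniteFieldProperties F
  open LinearisedPolys F q n renaming (_^_ to _^ᴸ_)
  open ≡-Reasoning

  N : ℕ
  N = q ℕ.^ n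

  ^ᴸ≡^ : ∀ x k → x ^ᴸ k ≡ x ^ k
  ^ᴸ≡^ x zero    = refl
  ^ᴸ≡^ x (suc k) = cong (x *_) (^ᴸ≡^ x k)

  Q : Fin n → ℕ
  Q i = q ℕ.^ toℕ i

  0<Q : ∀ i → 0 < Q i
  0<Q i = ℕ.m^n>0 q {{ℕ.>-nonZero (ℕ.<-trans (s≤s z≤n) 1<q)}} (toℕ i)

  Q<N : ∀ i → Q i < N
  Q<N i = ℕ.^-monoʳ-< q 1<q (Fin.toℕ<n i)

  Q-injective : ∀ {i j} → Q i ≡ Q j → i ≡ j
  Q-injective {i} {j} Qi≡Qj with ℕ.<-cmp (toℕ i) (toℕ j)
  ... | tri< i<j _ _ = ⊥-elim (ℕ.<-irrefl Qi≡Qj (ℕ.^-monoʳ-< q 1<q i<j))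
  ... | tri≈ _ i≡j _ = Fin.toℕ-injective i≡j
  ... | tri> _ _ j<i = ⊥-elim (ℕ.<-irrefl (sym Qi≡Qj) (ℕ.^-monoʳ-< q 1<q j<i))

  toℕ-sub-mod : ∀ k i → toℕ (sub-mod k i) ≡ (toℕ k ℕ.+ (n ∸ toℕ i)) % n
  toℕ-sub-mod k i = Fin.toℕ-fromℕ< _

  Opposite : Fin n → Fin n → Set
  Opposite a b = n ∣ toℕ a ℕ.+ toℕ b

  opposite-sym : ∀ {a b} → Opposite a b → Opposite b a
  opposite-sym {a} {b} = subst (n ∣_) (ℕ.+-comm (toℕ a) (toℕ b))

  opposite : Fin n → Fin n
  opposite a = fromℕ< (m%n<n (n ∸ toℕ a) n)

  opposite-Opposite : ∀ a → Opposite a (opposite a)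
  opposite-Opposite a = m%n≡0⇒n∣m _ n (begin
    (toℕ a ℕ.+ toℕ (opposite a)) % n  ≡⟨ cong (λ r → (toℕ a ℕ.+ r) % n) (Fin.toℕ-fromℕ< _) ⟩
    (toℕ a ℕ.+ (n ∸ toℕ a) % n) % n  ≡⟨ cong (_% n) (ℕ.+-comm (toℕ a) _) ⟩
    ((n ∸ toℕ a) % n ℕ.+ toℕ a) % n  ≡⟨ [m%d+n]%d≡[m+n]%d (n ∸ toℕ a) (toℕ a) n ⟩
    ((n ∸ toℕ a) ℕ.+ toℕ a) % n      ≡⟨ cong (_% n) (ℕ.m∸n+n≡m (ℕ.<⇒≤ (Fin.toℕ<n a))) ⟩
    n % n                            ≡⟨ n%n≡0 n ⟩
    0                                ∎)

  n∣[n∸a]+[n∸b] : ∀ {a b} → Opposite a b → n ∣ (n ∸ toℕ a) ℕ.+ (n ∸ toℕ b)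
  n∣[n∸a]+[n∸b] {a} {b} = ∣m+n∣m⇒∣n (subst (n ∣_) (sym sum≡n+n) (∣m∣n⇒∣m+n ∣-refl ∣-refl))
    where
    open CommutativeSemigroupProperties ℕ.+-commutativeSemigroup using (interchange)
    sum≡n+n : toℕ a ℕ.+ toℕ b ℕ.+ ((n ∸ toℕ a) ℕ.+ (n ∸ toℕ b)) ≡ n ℕ.+ n
    sum≡n+n = trans (interchange (toℕ a) (toℕ b) _ _)
                    (cong₂ ℕ._+_ (ℕ.m+[n∸m]≡n (ℕ.<⇒≤ (Fin.toℕ<n a))) (ℕ.m+[n∸m]≡n (ℕ.<⇒≤ (Fin.toℕ<n b))))

  sub-mod-sub-mod : ∀ {a b} → Opposite a b → ∀ k → sub-mod (sub-mod k a) b ≡ k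
  sub-mod-sub-mod {a} {b} opp k = Fin.toℕ-injective (begin
    toℕ (sub-mod (sub-mod k a) b)                        ≡⟨ toℕ-sub-mod (sub-mod k a) b ⟩
    (toℕ (sub-mod k a) ℕ.+ (n ∸ toℕ b)) % n              ≡⟨ cong (λ r → (r ℕ.+ (n ∸ toℕ b)) % n) (toℕ-sub-mod k a) ⟩
    ((toℕ k ℕ.+ (n ∸ toℕ a)) % n ℕ.+ (n ∸ toℕ b)) % n    ≡⟨ [m%d+n]%d≡[m+n]%d _ (n ∸ toℕ b) n ⟩
    (toℕ k ℕ.+ (n ∸ toℕ a) ℕ.+ (n ∸ toℕ b)) % n          ≡⟨ cong (_% n) (ℕ.+-assoc (toℕ k) _ _) ⟩
    (toℕ k ℕ.+ ((n ∸ toℕ a) ℕ.+ (n ∸ toℕ b))) % n        ≡⟨ %-remove-+ʳ (toℕ k) (n∣[n∸a]+[n∸b] {a} {b} opp) ⟩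
    toℕ k % n                                            ≡⟨ m<n⇒m%n≡m (Fin.toℕ<n k) ⟩
    toℕ k                                                ∎)

  x^[Qb*Qa]≡x : ∀ {a b} → Opposite a b → ∀ x → x ^ (Q b ℕ.* Q a) ≡ x
  x^[Qb*Qa]≡x {a} {b} (divides t a+b≡t*n) x = begin
    x ^ (Q b ℕ.* Q a)                   ≡⟨ cong (x ^_) (ℕ.^-distribˡ-+-* q (toℕ b) (toℕ a)) ⟨
    x ^ (q ℕ.^ (toℕ b ℕ.+ toℕ a))       ≡⟨ cong (λ e → x ^ (q ℕ.^ e)) (trans (ℕ.+-comm (toℕ b) (toℕ a)) a+b≡t*n) ⟩
    x ^ (q ℕ.^ (t ℕ.* n))               ≡⟨ cong (λ e → x ^ (q ℕ.^ e)) (ℕ.*-comm t n) ⟩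
    x ^ (q ℕ.^ (n ℕ.* t))               ≡⟨ cong (x ^_) (ℕ.^-*-assoc q n t) ⟨
    x ^ (N ℕ.^ t)                       ≡⟨ x^[N^t]≡x t x ⟩
    x                                   ∎

  monomial-≢ : ∀ {m i} → i ≢ m → monomial m i ≡ 0#
  monomial-≢ {m} {i} i≢m with i Fin.≟ m
  ... | yes i≡m = ⊥-elim (i≢m i≡m)
  ... | no _    = refl

  monomial-≡ : ∀ m → monomial m m ≡ 1#
  monomial-≡ m with m Fin.≟ m
  ... | yes _   = refl
  ... | no m≢m = ⊥-elim (m≢m refl)

  ∘-congʳ : ∀ g {f f′} → f ≗ᴸ f′ → (g ∘ᴸ f) ≗ᴸ (g ∘ᴸ f′)
  ∘-congʳ g f≗f′ k = Sum.sum-cong-≗ λ i → cong (λ y → g i * y ^ᴸ Q i) (f≗f′ (sub-mod k i))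

  monomial-∘ : ∀ m f k → (monomial m ∘ᴸ f) k ≡ f (sub-mod k m) ^ Q m
  monomial-∘ m f k = begin
    (monomial m ∘ᴸ f) k
      ≡⟨ sum-single +-commutativeMonoid _ m (λ i i≢m → trans (cong (_* _) (monomial-≢ i≢m)) (zeroˡ _)) ⟩
    monomial m m * f (sub-mod k m) ^ᴸ Q m  ≡⟨ cong (_* f (sub-mod k m) ^ᴸ Q m) (monomial-≡ m) ⟩
    1# * f (sub-mod k m) ^ᴸ Q m            ≡⟨ *-identityˡ _ ⟩
    f (sub-mod k m) ^ᴸ Q m                 ≡⟨ ^ᴸ≡^ _ (Q m) ⟩
    f (sub-mod k m) ^ Q m                  ∎

  monomial-∘-opposite : ∀ {a b} → Opposite a b → ∀ h → (monomial a ∘ᴸ (monomial b ∘ᴸ h)) ≗ᴸ h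
  monomial-∘-opposite {a} {b} opp h k = begin
    (monomial a ∘ᴸ (monomial b ∘ᴸ h)) k          ≡⟨ monomial-∘ a (monomial b ∘ᴸ h) k ⟩
    (monomial b ∘ᴸ h) (sub-mod k a) ^ Q a        ≡⟨ cong (_^ Q a) (monomial-∘ b h _) ⟩
    (h (sub-mod (sub-mod k a) b) ^ Q b) ^ Q a    ≡⟨ ^-assocʳ _ (Q b) (Q a) ⟩
    h (sub-mod (sub-mod k a) b) ^ (Q b ℕ.* Q a)  ≡⟨ cong (λ j → h j ^ (Q b ℕ.* Q a)) (sub-mod-sub-mod {a} {b} opp k) ⟩
    h k ^ (Q b ℕ.* Q a)                          ≡⟨ x^[Qb*Qa]≡x {a} {b} opp (h k) ⟩
    h k                                          ∎

  ∘-scalar : ∀ g β f k → (g ∘ᴸ (β ·ᴸ f)) k ≡ Sum.sum (λ i → β ^ Q i * (g i * f (sub-mod k i) ^ Q i))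
  ∘-scalar g β f k = Sum.sum-cong-≗ λ i → begin
    g i * (β * f (sub-mod k i)) ^ᴸ Q i       ≡⟨ cong (g i *_) (^ᴸ≡^ _ (Q i)) ⟩
    g i * (β * f (sub-mod k i)) ^ Q i        ≡⟨ cong (g i *_) (^-distrib-* β _ (Q i)) ⟩
    g i * (β ^ Q i * f (sub-mod k i) ^ Q i)  ≡⟨ x*yz≡y*xz (g i) _ _ ⟩
    β ^ Q i * (g i * f (sub-mod k i) ^ Q i)  ∎

  ∑ᴸ : ∀ {M} → (Fin M → LinPoly) → LinPoly
  ∑ᴸ v k = Sum.sum (λ j → v j k)

  module _ {C : LinPoly → Set} (C-subspace : IsSubspace C) where
    open IsSubspace C-subspace

    ∑ᴸ-closed : ∀ {M} (v : Fin M → LinPoly) → (∀ j → C (v j)) → C (∑ᴸ v)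
    ∑ᴸ-closed {zero}  v _   = has-zero
    ∑ᴸ-closed {suc M} v v∈C = closed-+ (v∈C zero) (∑ᴸ-closed (v ∘ suc) (v∈C ∘ suc))

    ·-cancel-closed : ∀ {α f} → α ≢ 0# → C (α ·ᴸ f) → C f
    ·-cancel-closed {α} {f} α≢0 αf∈C = respects (λ k → x⁻¹*[x*y]≡y α≢0 (f k)) (closed-· (x⁻¹ α≢0) αf∈C)

  module _ (m : Fin n) where
    weight : Carrier → Carrier
    weight β = β ^ (N ∸ 1 ∸ Q m)

    χ : Fin n → Carrier
    χ i = ∑ᶠ (λ β → weight β * β ^ Q i)

    χᵢ≡0 : ∀ {i} → i ≢ m → χ i ≡ 0#
    χᵢ≡0 {i} i≢m = ∑ᶠ-^-orthogonal (0<Q m) (0<Q i) (Q<N m) (Q<N i) (i≢m ∘ sym ∘ Q-injective)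

    χₘ≢0 : χ m ≢ 0#
    χₘ≢0 = ∑ᶠ-^-diagonal (Q<N m)

    weighted-sum≗monomial-∘ : ∀ g f → ∑ᴸ (λ j → weight (element j) ·ᴸ (g ∘ᴸ (element j ·ᴸ f)))
                                      ≗ᴸ ((χ m * g m) ·ᴸ (monomial m ∘ᴸ f))
    weighted-sum≗monomial-∘ g f k = begin
      Sum.sum (λ j → w j * (g ∘ᴸ (element j ·ᴸ f)) k)
        ≡⟨ Sum.sum-cong-≗ (λ j → cong (w j *_) (∘-scalar g (element j) f k)) ⟩
      Sum.sum (λ j → w j * Sum.sum (λ i → element j ^ Q i * t i))
        ≡⟨ Sum.sum-cong-≗ (λ j → Sum.*-distribˡ-sum (w j) (λ i → element j ^ Q i * t i)) ⟩
      Sum.sum (λ j → Sum.sum (λ i → w j * (element j ^ Q i * t i)))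
        ≡⟨ Sum.sum-cong-≗ (λ j → Sum.sum-cong-≗ λ i → sym (*-assoc (w j) _ (t i))) ⟩
      Sum.sum (λ j → Sum.sum (λ i → w j * element j ^ Q i * t i))
        ≡⟨ Sum.∑-comm (λ j i → w j * element j ^ Q i * t i) ⟩
      Sum.sum (λ i → Sum.sum (λ j → w j * element j ^ Q i * t i))
        ≡⟨ Sum.sum-cong-≗ (λ i → sym (Sum.*-distribʳ-sum (t i) (λ j → w j * element j ^ Q i))) ⟩
      Sum.sum (λ i → χ i * t i)
        ≡⟨ sum-single +-commutativeMonoid (λ i → χ i * t i) m (λ i i≢m →
             trans (cong (_* t i) (χᵢ≡0 i≢m)) (zeroˡ (t i))) ⟩
      χ m * (g m * f (sub-mod k m) ^ Q m)
        ≡⟨ sym (*-assoc (χ m) (g m) _) ⟩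
      χ m * g m * f (sub-mod k m) ^ Q m
        ≡⟨ cong (χ m * g m *_) (sym (monomial-∘ m f k)) ⟩
      χ m * g m * (monomial m ∘ᴸ f) k
        ∎
      where
      w : Fin N → Carrier
      w = weight ∘ element
      t : Fin n → Carrier
      t i = g i * f (sub-mod k i) ^ Q i

    monomial-∘-∈-∘ˢ : ∀ {C g} → IsSubspace C → IsSubspace (g ∘ˢ C) → g m ≢ 0# →
                      ∀ {f} → C f → (g ∘ˢ C) (monomial m ∘ᴸ f)
    monomial-∘-∈-∘ˢ {C} {g} C-subspace g∘ˢC-subspace gₘ≢0 {f} f∈C =
      ·-cancel-closed g∘ˢC-subspace (x*y≢0 χₘ≢0 gₘ≢0)
        (respects (weighted-sum≗monomial-∘ g f) (∑ᴸ-closed g∘ˢC-subspace summand λ j →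
          closed-· (weight (element j)) (element j ·ᴸ f , IsSubspace.closed-· C-subspace (element j) f∈C , λ _ → refl)))
      where
      open IsSubspace g∘ˢC-subspace
      summand : Fin N → LinPoly
      summand j = weight (element j) ·ᴸ (g ∘ᴸ (element j ·ᴸ f))

  module _ {C} (C-subspace : IsSubspace C) {g} (g∘ˢC-subspace : IsSubspace (g ∘ˢ C)) {m} (gₘ≢0 : g m ≢ 0#) where
    monomial∘ˢ⊆∘ˢ : ∀ h → (monomial m ∘ˢ C) h → (g ∘ˢ C) h
    monomial∘ˢ⊆∘ˢ h (f , f∈C , h≗mf) =
      IsSubspace.respects g∘ˢC-subspace (sym ∘ h≗mf) (monomial-∘-∈-∘ˢ m C-subspace g∘ˢC-subspace gₘ≢0 f∈C)

    ∘ˢ⊆monomial∘ˢ : ∀ h → (g ∘ˢ C) h → (monomial m ∘ˢ C) h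
    ∘ˢ⊆monomial∘ˢ h (f , f∈C , h≗gf) =
      Ψ f , Ψ-closed f∈C , λ k →
        trans (h≗gf k) (sym (monomial-∘-opposite {m} {opposite m} (opposite-Opposite m) (g ∘ᴸ f) k))
      where
      Ψ : LinPoly → LinPoly
      Ψ f = monomial (opposite m) ∘ᴸ (g ∘ᴸ f)

      preimage : ∀ {f} → C f → ∃ λ f′ → C f′ × Ψ f′ ≗ᴸ f
      preimage {f} f∈C =
        let f′ , f′∈C , mf≗gf′ = monomial-∘-∈-∘ˢ m C-subspace g∘ˢC-subspace gₘ≢0 f∈C in
        f′ , f′∈C , λ k → trans (∘-congʳ (monomial (opposite m)) (sym ∘ mf≗gf′) k)
                                (monomial-∘-opposite {opposite m} {m} (opposite-sym {m} (opposite-Opposite m)) f k)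

      Ψ-closed : ∀ {f} → C f → C (Ψ f)
      Ψ-closed = onto⇒closed (Fin n →-setoid Carrier) {P = C} {Ψ = Ψ} encode encode-injective
                   (IsSubspace.respects C-subspace) (∘-congʳ (monomial (opposite m)) ∘ ∘-congʳ g) preimage

mainTheorem3 : (q n : ℕ) → 2 ≤ q → {{nz : NonZero n}} → (F : FiniteField (q Data.Nat.^ n)) →
    (C : LinearisedPolys.LinPoly F q n → Set) →
    LinearisedPolys.IsSubspace F q n C →
    (g : LinearisedPolys.LinPoly F q n) →
    LinearisedPolys.Invertible F q n g →
    LinearisedPolys.IsSubspace F q n (LinearisedPolys._∘ˢ_ F q n g C) →
    (m : Fin n) → g m ≢ FiniteField.0# F →
    LinearisedPolys._≐_ F q n (LinearisedPolys._∘ˢ_ F q n g C)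
      (LinearisedPolys._∘ˢ_ F q n (LinearisedPolys.monomial F q n m) C)
mainTheorem3 q n 2≤q F C C-subspace g _ g∘ˢC-subspace m gₘ≢0 =
  ∘ˢ⊆monomial∘ˢ C-subspace g∘ˢC-subspace gₘ≢0 , monomial∘ˢ⊆∘ˢ C-subspace g∘ˢC-subspace gₘ≢0
  where open LinearisedCompositions q n 2≤q F
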